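{- Let $G=(V,E,w)$ be an undirected graph with positive edge weights, let $k\ge1$ be an integer and $\varepsilon>0$. Let $\mathcal{M}=\{M_1,\dots,M_k\}$ be the output of Algorithm STK (described in the context) on $G,k,\varepsilon$, let $\phi(c,v)$ denote the values of its variables at termination, and for each $e=(u,v)\in E$ let $$z(e)=\max\Big\{0,\ \max_{c\in[k]}\big\{w(e)-(1+\varepsilon)(\phi(c,u)+\phi(c,v))\big\}\Big\}.$$ Then $w(\mathcal{M})\ge\sum_{e\in E}z(e)$, where $w(\mathcal{M})=\sum_{c\in[k]}\sum_{e\in M_c}w(e)$.
   Context: $[t]$ denotes $\{1,\dots,t\}$. Algorithm STK (input: the edges of $E$ presented one at a time in an arbitrary order, an integer $k$, and $\varepsilon>0$): Initialization: set $\phi(c,v)=0$ for all $c\in[k]$, $v\in V$; create $k$ empty stacks $S(1),\dots,S(k)$. Streaming phase: for each arriving edge $e=(u,v)$, for $c=1,2,\dots,k$ in order: let $\phi_c=\phi(c,u)+\phi(c,v)$; if $w(e)\ge(1+\varepsilon)\phi_c$, then set $w'(c,e)=w(e)-\phi_c$, increase both $\phi(c,u)$ and $\phi(c,v)$ by $w'(c,e)$, push $e$ onto $S(c)$, and stop processing $e$. If no $c$ satisfies the condition, $e$ is discarded. Post-processing: set $M_c=\emptyset$ for all $c\in[k]$. For $c=1,\dots,k$ in increasing order: while $S(c)$ is nonempty, pop the top edge $e=(u,v)$ of $S(c)$; if neither $u$ nor $v$ is an endpoint of an edge in $M_c$, add $e$ to $M_c$; otherwise, for $j=c+1,\dots,k$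 in order: let $\phi_j=\phi(j,u)+\phi(j,v)$; if $w(e)\ge(1+\varepsilon)\phi_j$, set $w'(j,e)=w(e)-\phi_j$, increase both $\phi(j,u)$ and $\phi(j,v)$ by $w'(j,e)$, push $e$ onto $S(j)$, and stop; if no such $j$ exists, $e$ is discarded. Output: $\mathcal{M}=\{M_1,\dots,M_k\}$.
   Formalization: The edge weights and the parameter ε are taken to be rational numbers. -}

module Defs where

open import Data.Nat using (ℕ)
open import Data.Fin using (Fin; _≟_; _<?_)
open import Data.List using (List; []; _∷_; foldl; foldr; filter; map; allFin)
open import Data.Bool.ListAction using (any)
open import Data.List.Relation.Unary.AllPairs using (AllPairs)
open import Data.List.Relation.Unary.All using (All)
open import Data.Product using (_×_; _,_)
open import Data.Sum using (_⊎_)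
open import Data.Bool using (Bool; true; false; if_then_else_; _∨_)
open import Relation.Nullary using (¬_; yes; no; does)
open import Relation.Binary.PropositionalEquality using (_≡_; _≢_)
open import Data.Rational using (ℚ; 0ℚ; 1ℚ; _+_; _*_; _-_; _⊔_; _≤?_; _<_)


record Edge (n : ℕ) : Set where
  constructor edge
  field
    eu : Fin n
    ev : Fin n
    ew : ℚ
open Edge public

SameEnds : {n : ℕ} → Edge n → Edge n → Set
SameEnds e f = (eu e ≡ eu f × ev e ≡ ev f) ⊎ (eu e ≡ ev f × ev e ≡ eu f)

IsWeightedGraph : {n : ℕ} → List (Edge n) → Set
IsWeightedGraph es =
  All (λ e → eu e ≢ ev e) es
  × All (λ e → 0ℚ < ew e) es
  × AllPairs (λ e f → ¬ SameEnds e f) es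

-- Algorithm state: potentials φ(c,v), stacks S(c) (head = top), matchings M_c.
record State (n k : ℕ) : Set where
  constructor st
  field
    φ     : Fin k → Fin n → ℚ
    stack : Fin k → List (Edge n)
    match : Fin k → List (Edge n)
open State public

updPot : {n k : ℕ} → (Fin k → Fin n → ℚ) → Fin k → Fin n → ℚ → (Fin k → Fin n → ℚ)
updPot φ c x δ c' x' with does (c ≟ c') | does (x ≟ x')
... | true  | true = φ c' x' + δ
... | _     | _    = φ c' x'

updList : {n k : ℕ} → (Fin k → List (Edge n)) → Fin k → List (Edge n) → (Fin k → List (Edge n))
updList S c l c' = if does (c ≟ c') then l else S c'

tryColors : {n k : ℕ} → ℚ → List (Fin k) → State n k → Edge n → State n k
tryColors ε [] s e = s
tryColors ε (c ∷ cs) s e with ((1ℚ + ε) * (φ s c (eu e) + φ s c (ev e))) ≤? ew e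
... | yes _ =
  let φc  = φ s c (eu e) + φ s c (ev e)
      w'  = ew e - φc
      φ₁  = updPot (φ s) c (eu e) w'
      φ₂  = updPot φ₁ c (ev e) w'
  in st φ₂ (updList (stack s) c (e ∷ stack s c)) (match s)
... | no _ = tryColors ε cs s e

colorsAbove : {k : ℕ} → Fin k → List (Fin k)
colorsAbove {k} c = filter (λ j → c <? j) (allFin k)

initState : (n k : ℕ) → State n k
initState n k = st (λ _ _ → 0ℚ) (λ _ → []) (λ _ → [])

streamPhase : {n : ℕ} (k : ℕ) → ℚ → List (Edge n) → State n k
streamPhase {n} k ε es = foldl (λ s e → tryColors ε (allFin k) s e) (initState n k) es

touches : {n : ℕ} → Fin n → List (Edge n) → Bool
touches x M = any (λ f → does (x ≟ eu f) ∨ does (x ≟ ev f)) M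

popStep : {n k : ℕ} → ℚ → Fin k → State n k → Edge n → State n k
popStep ε c s e =
  if touches (eu e) (match s c) ∨ touches (ev e) (match s c)
  then tryColors ε (colorsAbove c) s e
  else st (φ s) (stack s) (updList (match s) c (e ∷ match s c))

-- Process color c: pop S(c) until empty.  (Nothing is pushed onto S(c)
-- while processing c, since re-insertions only go to colors j > c, so
-- popping the snapshot of S(c) top-first is exactly the while-loop.)
processColor : {n k : ℕ} → ℚ → State n k → Fin k → State n k
processColor ε s c =
  foldl (popStep ε c) (st (φ s) (updList (stack s) c []) (match s)) (stack s c)

postPhase : {n k : ℕ} → ℚ → State n k → State n k
postPhase {k = k} ε s = foldl (processColor ε) s (allFin k)

STK : {n : ℕ} (k : ℕ) → ℚ → List (Edge n) → State n k
STK k ε es = postPhase ε (streamPhase k ε es)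

sumℚ : List ℚ → ℚ
sumℚ = foldr _+_ 0ℚ

weightOf : {n k : ℕ} → State n k → ℚ
weightOf {k = k} s = sumℚ (map (λ c → sumℚ (map ew (match s c))) (allFin k))

zVal : {n k : ℕ} → ℚ → (Fin k → Fin n → ℚ) → Edge n → ℚ
zVal {k = k} ε φ e =
  foldr _⊔_ 0ℚ (map (λ c → ew e - (1ℚ + ε) * (φ c (eu e) + φ c (ev e))) (allFin k))

{-# OPTIONS --safe #-}
module Submission where

-- Fix the final potentials F, compute z from F, and follow
--   Φ(s) = Σ z(e) over the edges on the stacks + the weight of the matchings.
-- Potentials only grow.  So a colour that rejected e stays covered at e,
-- w(e) ≤ (1+ε)(F(c,u)+F(c,v)), and so does the colour that accepted e, whose
-- potentials were raised to absorb w(e).  Hence an edge on S(c) is covered by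
-- every colour ≤ c and a discarded edge by every colour: discarding costs
-- z(e) = 0, pushing adds z(e), and matching trades z(e) for w(e) ≥ z(e).
-- Streaming therefore raises Φ by at least Σ z(e), post-processing never lowers
-- it, and at the end all stacks are empty, so Φ = w(𝓜).

open import Defs
open import Data.Nat using (ℕ; _≤_)
open import Data.List using (List; map)
open import Data.Rational using (ℚ; 0ℚ; _<_)
open import Data.Rational using () renaming (_≤_ to _≤ℚ_)

open import Algebra.Bundles using (CommutativeMonoid)
open import Data.Bool using (true; false; _∨_)
open import Data.Empty using (⊥-elim)
open import Data.Fin as Fin using (Fin; zero; suc; _≟_; _<?_)
import Data.Fin.Properties as FinP
open import Data.List using ([]; _∷_; foldl; foldr; allFin; tabulate)
open import Data.List.Properties using (map-tabulate; tabulate-cong)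
open import Data.List.Membership.Propositional using (_∈_; _∉_)
open import Data.List.Membership.Propositional.Properties using (∈-allFin; ∈-filter⁺; ∈-filter⁻)
open import Data.List.Relation.Unary.All as All using (All; []; _∷_)
open import Data.List.Relation.Unary.AllPairs using (AllPairs; []; _∷_)
import Data.List.Relation.Unary.AllPairs.Properties as AllPairs
open import Data.List.Relation.Unary.Any using (here; there)
import Data.Nat.Properties as ℕ
open import Data.Product using (_×_; _,_; proj₁; proj₂)
open import Data.Rational using (1ℚ; _+_; _*_; _-_; -_; _⊔_; _≤?_; nonNegative)
import Data.Rational.Properties as ℚP
open import Data.Rational.Solver using (module +-*-Solver)
open import Algebra.Properties.CommutativeSemigroup
  (CommutativeMonoid.commutativeSemigroup ℚP.+-0-commutativeMonoid)
  using (x∙yz≈y∙xz; xy∙z≈x∙zy; xy∙z≈zx∙y; xy∙z≈yz∙x)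
open import Data.Sum using (_⊎_; inj₁; inj₂)
open import Data.Unit using (⊤; tt)
open import Function using (_∘_; id)
open import Relation.Nullary using (yes; no)
open import Relation.Binary.PropositionalEquality

p≤p+q : ∀ p {q} → 0ℚ ≤ℚ q → p ≤ℚ p + q
p≤p+q p 0≤q = subst (_≤ℚ p + _) (ℚP.+-identityʳ p) (ℚP.+-monoʳ-≤ p 0≤q)

p+q≤p : ∀ p {q} → q ≤ℚ 0ℚ → p + q ≤ℚ p
p+q≤p p q≤0 = subst (p + _ ≤ℚ_) (ℚP.+-identityʳ p) (ℚP.+-monoʳ-≤ p q≤0)

p-q≤p : ∀ p {q} → 0ℚ ≤ℚ q → p - q ≤ℚ p
p-q≤p p 0≤q = p+q≤p p (ℚP.neg-antimono-≤ 0≤q)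

0≤q-p : ∀ {p q} → p ≤ℚ q → 0ℚ ≤ℚ q - p
0≤q-p {p} {q} p≤q = subst (_≤ℚ q - p) (ℚP.+-inverseʳ p) (ℚP.+-monoˡ-≤ (- p) p≤q)

p-q≤0 : ∀ {p q} → p ≤ℚ q → p - q ≤ℚ 0ℚ
p-q≤0 {p} {q} p≤q = subst (p - q ≤ℚ_) (ℚP.+-inverseʳ q) (ℚP.+-monoˡ-≤ (- q) p≤q)

module _ {ε : ℚ} (0≤ε : 0ℚ ≤ℚ ε) where

  p≤[1+ε]p : ∀ {p} → 0ℚ ≤ℚ p → p ≤ℚ (1ℚ + ε) * p
  p≤[1+ε]p {p} 0≤p = begin
    p              ≤⟨ p≤p+q p 0≤εp ⟩
    p + ε * p      ≡⟨ cong (_+ ε * p) (ℚP.*-identityˡ p) ⟨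
    1ℚ * p + ε * p ≡⟨ ℚP.*-distribʳ-+ p 1ℚ ε ⟨
    (1ℚ + ε) * p   ∎
    where
    open ℚP.≤-Reasoning
    0≤εp = subst (_≤ℚ ε * p) (ℚP.*-zeroʳ ε)
             (ℚP.*-monoˡ-≤-nonNeg ε {{nonNegative 0≤ε}} 0≤p)

  0≤[1+ε]p : ∀ {p} → 0ℚ ≤ℚ p → 0ℚ ≤ℚ (1ℚ + ε) * p
  0≤[1+ε]p 0≤p = ℚP.≤-trans 0≤p (p≤[1+ε]p 0≤p)

  [1+ε]*-mono : ∀ {p q} → p ≤ℚ q → (1ℚ + ε) * p ≤ℚ (1ℚ + ε) * q
  [1+ε]*-mono = ℚP.*-monoˡ-≤-nonNeg (1ℚ + ε) {{1+ε≥0}}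
    where 1+ε≥0 = nonNegative (ℚP.≤-trans (ℚP.nonNegative⁻¹ 1ℚ) (p≤p+q 1ℚ 0≤ε))

foldr-⊔-lub : ∀ {A : Set} (f : A → ℚ) xs {b} → 0ℚ ≤ℚ b → (∀ x → f x ≤ℚ b) →
  foldr _⊔_ 0ℚ (map f xs) ≤ℚ b
foldr-⊔-lub f []       0≤b f≤b = 0≤b
foldr-⊔-lub f (x ∷ xs) 0≤b f≤b = ℚP.⊔-lub (f≤b x) (foldr-⊔-lub f xs 0≤b f≤b)

sumℚ-zeros : ∀ {A : Set} (f : A → ℚ) xs → (∀ x → f x ≡ 0ℚ) → sumℚ (map f xs) ≡ 0ℚ
sumℚ-zeros f []       f≡0 = refl
sumℚ-zeros f (x ∷ xs) f≡0 = cong₂ _+_ (f≡0 x) (sumℚ-zeros f xs f≡0)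

sumℚ-tabulate-update : ∀ {k} (g g′ : Fin k → ℚ) c d →
  (∀ j → j ≢ c → g′ j ≡ g j) → g′ c ≡ d + g c →
  sumℚ (tabulate g′) ≡ d + sumℚ (tabulate g)
sumℚ-tabulate-update g g′ zero d off at = begin
  g′ zero + sumℚ (tabulate (g′ ∘ suc))      ≡⟨ cong₂ _+_ at (cong sumℚ (tabulate-cong rest)) ⟩
  (d + g zero) + sumℚ (tabulate (g ∘ suc))  ≡⟨ ℚP.+-assoc d _ _ ⟩
  d + sumℚ (tabulate g)                     ∎
  where
  open ≡-Reasoning
  rest = λ j → off (suc j) λ ()
sumℚ-tabulate-update g g′ (suc c) d off at = begin
  g′ zero + sumℚ (tabulate (g′ ∘ suc))      ≡⟨ cong₂ _+_ (off zero λ ()) rest ⟩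
  g zero + (d + sumℚ (tabulate (g ∘ suc)))  ≡⟨ x∙yz≈y∙xz (g zero) d _ ⟩
  d + sumℚ (tabulate g)                     ∎
  where
  open ≡-Reasoning
  rest = sumℚ-tabulate-update (g ∘ suc) (g′ ∘ suc) c d
           (λ j j≢c → off (suc j) (j≢c ∘ FinP.suc-injective)) at

sumℚ-allFin-update : ∀ {k} (g g′ : Fin k → ℚ) c d →
  (∀ j → j ≢ c → g′ j ≡ g j) → g′ c ≡ d + g c →
  sumℚ (map g′ (allFin k)) ≡ d + sumℚ (map g (allFin k))
sumℚ-allFin-update g g′ c d off at
  rewrite map-tabulate id g | map-tabulate id g′ = sumℚ-tabulate-update g g′ c d off at

allFin-sorted : ∀ {k} → AllPairs Fin._<_ (allFin k)
allFin-sorted = AllPairs.tabulate⁺-< id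

foldl-invariant : ∀ {A B C : Set} (g : B → C) {f : B → A → B} →
  (∀ b a → g (f b a) ≡ g b) → ∀ b as → g (foldl f b as) ≡ g b
foldl-invariant g g-inv b []       = refl
foldl-invariant g g-inv b (a ∷ as) = trans (foldl-invariant g g-inv _ as) (g-inv b a)

module _ {n k : ℕ} where

  updList-same : ∀ (S : Fin k → List (Edge n)) c l → updList S c l c ≡ l
  updList-same S c l with c ≟ c
  ... | yes _  = refl
  ... | no c≢c = ⊥-elim (c≢c refl)

  updList-other : ∀ (S : Fin k → List (Edge n)) c l {j} → j ≢ c → updList S c l j ≡ S j
  updList-other S c l {j} j≢c with c ≟ j
  ... | yes c≡j = ⊥-elim (j≢c (sym c≡j))
  ... | no _    = refl

  updList-elim : ∀ (P : Fin k → List (Edge n) → Set) (S : Fin k → List (Edge n)) c l →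
    P c l → (∀ j → P j (S j)) → ∀ j → P j (updList S c l j)
  updList-elim P S c l Pl PS j with c ≟ j
  ... | yes refl = Pl
  ... | no _     = PS j

  total : (Edge n → ℚ) → (Fin k → List (Edge n)) → ℚ
  total f S = sumℚ (map (λ c → sumℚ (map f (S c))) (allFin k))

  total-push : ∀ f S c e → total f (updList S c (e ∷ S c)) ≡ f e + total f S
  total-push f S c e = sumℚ-allFin-update _ _ c (f e)
    (λ j j≢c → cong (sumℚ ∘ map f) (updList-other S c _ j≢c))
    (cong (sumℚ ∘ map f) (updList-same S c _))

  total-clear : ∀ f S c → total f S ≡ sumℚ (map f (S c)) + total f (updList S c [])
  total-clear f S c = sumℚ-allFin-update _ _ c (sumℚ (map f (S c)))
    (λ j j≢c → cong (sumℚ ∘ map f) (sym (updList-other S c [] j≢c)))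
    (trans (sym (ℚP.+-identityʳ _))
           (cong (λ l → sumℚ (map f (S c)) + sumℚ (map f l)) (sym (updList-same S c []))))

  total-empty : ∀ f S → (∀ c → S c ≡ []) → total f S ≡ 0ℚ
  total-empty f S empty = sumℚ-zeros _ (allFin k) (λ c → cong (sumℚ ∘ map f) (empty c))

  _≼_ : (ψ χ : Fin k → Fin n → ℚ) → Set
  ψ ≼ χ = ∀ c x → ψ c x ≤ℚ χ c x

  ≼-refl : ∀ {ψ} → ψ ≼ ψ
  ≼-refl c x = ℚP.≤-refl

  ≼-trans : ∀ {ψ χ ω} → ψ ≼ χ → χ ≼ ω → ψ ≼ ω
  ≼-trans ψ≼χ χ≼ω c x = ℚP.≤-trans (ψ≼χ c x) (χ≼ω c x)

  NonNeg : (Fin k → Fin n → ℚ) → Set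
  NonNeg ψ = ∀ c x → 0ℚ ≤ℚ ψ c x

  NonNeg-≼ : ∀ {ψ χ} → NonNeg ψ → ψ ≼ χ → NonNeg χ
  NonNeg-≼ ψ≥0 ψ≼χ c x = ℚP.≤-trans (ψ≥0 c x) (ψ≼χ c x)

  initState-nonneg : NonNeg (φ (initState n k))
  initState-nonneg c x = ℚP.≤-refl

  load : (Fin k → Fin n → ℚ) → Fin k → Edge n → ℚ
  load ψ c e = ψ c (eu e) + ψ c (ev e)

  load-mono : ∀ {ψ χ} → ψ ≼ χ → ∀ c e → load ψ c e ≤ℚ load χ c e
  load-mono ψ≼χ c e = ℚP.+-mono-≤ (ψ≼χ c (eu e)) (ψ≼χ c (ev e))

  load-nonneg : ∀ {ψ} → NonNeg ψ → ∀ c e → 0ℚ ≤ℚ load ψ c e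
  load-nonneg ψ≥0 c e = ℚP.+-mono-≤ (ψ≥0 c (eu e)) (ψ≥0 c (ev e))

  updPot-hit : ∀ (ψ : Fin k → Fin n → ℚ) c x δ → updPot ψ c x δ c x ≡ ψ c x + δ
  updPot-hit ψ c x δ with c ≟ c | x ≟ x
  ... | yes _  | yes _  = refl
  ... | yes _  | no x≢x = ⊥-elim (x≢x refl)
  ... | no c≢c | _      = ⊥-elim (c≢c refl)

  updPot-inflates : ∀ (ψ : Fin k → Fin n → ℚ) c x {δ} → 0ℚ ≤ℚ δ → ψ ≼ updPot ψ c x δ
  updPot-inflates ψ c x 0≤δ c′ x′ with c ≟ c′ | x ≟ x′
  ... | yes _ | yes _ = p≤p+q (ψ c′ x′) 0≤δ
  ... | yes _ | no _  = ℚP.≤-refl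
  ... | no _  | _     = ℚP.≤-refl

  -- Definitionally the update made by tryColors when colour c accepts e.
  raise : (Fin k → Fin n → ℚ) → Fin k → Edge n → (Fin k → Fin n → ℚ)
  raise ψ c e = updPot (updPot ψ c (eu e) (ew e - load ψ c e)) c (ev e) (ew e - load ψ c e)

  raise-inflates : ∀ ψ c e → 0ℚ ≤ℚ ew e - load ψ c e → ψ ≼ raise ψ c e
  raise-inflates ψ c e 0≤δ =
    ≼-trans (updPot-inflates ψ c (eu e) 0≤δ)
            (updPot-inflates (updPot ψ c (eu e) _) c (ev e) 0≤δ)

  raise-covers : ∀ ψ c e → 0ℚ ≤ℚ ew e - load ψ c e → ew e ≤ℚ load (raise ψ c e) c e
  raise-covers ψ c e 0≤δ = begin
    ew e                                 ≡⟨ cancel (ψ c (eu e)) (ψ c (ev e)) (ew e) ⟨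
    (ψ c (eu e) + δ) + ψ c (ev e)        ≤⟨ ℚP.+-monoʳ-≤ (ψ c (eu e) + δ) (p≤p+q _ 0≤δ) ⟩
    (ψ c (eu e) + δ) + (ψ c (ev e) + δ)  ≤⟨ ℚP.+-mono-≤ at-u at-v ⟩
    load (raise ψ c e) c e               ∎
    where
    open ℚP.≤-Reasoning
    open +-*-Solver
    δ = ew e - load ψ c e
    ψ₁ = updPot ψ c (eu e) δ
    cancel : ∀ a b w → (a + (w - (a + b))) + b ≡ w
    cancel = solve 3 (λ a b w → (a :+ (w :- (a :+ b))) :+ b := w) refl
    at-u : ψ c (eu e) + δ ≤ℚ raise ψ c e c (eu e)
    at-u = subst (_≤ℚ raise ψ c e c (eu e)) (updPot-hit ψ c (eu e) δ)
             (updPot-inflates ψ₁ c (ev e) 0≤δ c (eu e))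
    at-v : ψ c (ev e) + δ ≤ℚ raise ψ c e c (ev e)
    at-v = subst (ψ c (ev e) + δ ≤ℚ_) (sym (updPot-hit ψ₁ c (ev e) δ))
             (ℚP.+-monoˡ-≤ δ (updPot-inflates ψ c (eu e) 0≤δ c (ev e)))

  Inflationary : {A : Set} → (State n k → A → State n k) → Set
  Inflationary f = ∀ s a → NonNeg (φ s) → φ s ≼ φ (f s a)

  foldl-inflationary : ∀ {A} {f : State n k → A → State n k} →
    Inflationary f → Inflationary (foldl f)
  foldl-inflationary f↑ s []       s≥0 = ≼-refl
  foldl-inflationary f↑ s (a ∷ as) s≥0 =
    ≼-trans (f↑ s a s≥0) (foldl-inflationary f↑ _ as (NonNeg-≼ s≥0 (f↑ s a s≥0)))

module _ {n k : ℕ} {ε : ℚ} where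

  tryColors-match : ∀ (cs : List (Fin k)) (s : State n k) e → match (tryColors ε cs s e) ≡ match s
  tryColors-match []       s e = refl
  tryColors-match (c ∷ cs) s e with (1ℚ + ε) * load (φ s) c e ≤? ew e
  ... | yes _ = refl
  ... | no _  = tryColors-match cs s e

  tryColors-stack : ∀ (cs : List (Fin k)) (s : State n k) e {j} → j ∉ cs →
    stack (tryColors ε cs s e) j ≡ stack s j
  tryColors-stack []       s e j∉cs = refl
  tryColors-stack (c ∷ cs) s e j∉cs with (1ℚ + ε) * load (φ s) c e ≤? ew e
  ... | yes _ = updList-other (stack s) c _ (j∉cs ∘ here)
  ... | no _  = tryColors-stack cs s e (j∉cs ∘ there)

  popStep-stack : ∀ c (s : State n k) e {j} → j Fin.≤ c → stack (popStep ε c s e) j ≡ stack s j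
  popStep-stack c s e j≤c with touches (eu e) (match s c) ∨ touches (ev e) (match s c)
  ... | true  = tryColors-stack (colorsAbove c) s e
                  (λ j∈ → ℕ.<⇒≱ (proj₂ (∈-filter⁻ (c <?_) {xs = allFin k} j∈)) j≤c)
  ... | false = refl

  processColor-stack : ∀ (s : State n k) c {j} → j Fin.≤ c →
    stack (processColor ε s c) j ≡ updList (stack s) c [] j
  processColor-stack s c {j} j≤c =
    foldl-invariant (λ t → stack t j) (λ t e → popStep-stack c t e j≤c) _ (stack s c)

  processColors-stack : ∀ cs (s : State n k) {j} → All (j Fin.<_) cs →
    stack (foldl (processColor ε) s cs) j ≡ stack s j
  processColors-stack []       s []           = refl
  processColors-stack (c ∷ cs) s (j<c ∷ j<cs) =
    trans (processColors-stack cs _ j<cs)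
          (trans (processColor-stack s c (ℕ.<⇒≤ j<c))
                 (updList-other (stack s) c [] (FinP.<⇒≢ j<c)))

  processColors-clear : ∀ cs (s : State n k) {j} → AllPairs Fin._<_ cs → j ∈ cs →
    stack (foldl (processColor ε) s cs) j ≡ []
  processColors-clear (c ∷ cs) s (c<cs ∷ _) (here refl) =
    trans (processColors-stack cs _ c<cs)
          (trans (processColor-stack s c ℕ.≤-refl) (updList-same (stack s) c []))
  processColors-clear (c ∷ cs) s (_ ∷ sorted) (there j∈cs) = processColors-clear cs _ sorted j∈cs

  postPhase-clear : ∀ (s : State n k) j → stack (postPhase ε s) j ≡ []
  postPhase-clear s j = processColors-clear (allFin k) s allFin-sorted (∈-allFin j)

module _ {ε : ℚ} (0≤ε : 0ℚ ≤ℚ ε) {n k : ℕ} where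

  accept-slack : ∀ {ψ : Fin k → Fin n → ℚ} {c e} → NonNeg ψ →
    (1ℚ + ε) * load ψ c e ≤ℚ ew e → 0ℚ ≤ℚ ew e - load ψ c e
  accept-slack {c = c} {e} ψ≥0 accept =
    0≤q-p (ℚP.≤-trans (p≤[1+ε]p 0≤ε (load-nonneg ψ≥0 c e)) accept)

  tryColors-inflationary : ∀ cs → Inflationary (λ (s : State n k) e → tryColors ε cs s e)
  tryColors-inflationary []       s e s≥0 = ≼-refl
  tryColors-inflationary (c ∷ cs) s e s≥0 with (1ℚ + ε) * load (φ s) c e ≤? ew e
  ... | yes accept = raise-inflates (φ s) c e (accept-slack s≥0 accept)
  ... | no _       = tryColors-inflationary cs s e s≥0

  popStep-inflationary : ∀ c → Inflationary (popStep ε c)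
  popStep-inflationary c s e s≥0 with touches (eu e) (match s c) ∨ touches (ev e) (match s c)
  ... | true  = tryColors-inflationary (colorsAbove c) s e s≥0
  ... | false = ≼-refl

  processColor-inflationary : Inflationary (processColor ε)
  processColor-inflationary s c = foldl-inflationary (popStep-inflationary c) _ (stack s c)

  streamPhase-nonneg : ∀ es → NonNeg (φ (streamPhase k ε es))
  streamPhase-nonneg es = NonNeg-≼ initState-nonneg
    (foldl-inflationary (tryColors-inflationary (allFin k)) _ es initState-nonneg)

  streamPhase-≼-STK : ∀ es → φ (streamPhase k ε es) ≼ φ (STK k ε es)
  streamPhase-≼-STK es =
    foldl-inflationary processColor-inflationary _ (allFin k) (streamPhase-nonneg es)

  Covered : (Fin k → Fin n → ℚ) → Edge n → Fin k → Set
  Covered ψ e i = ew e ≤ℚ (1ℚ + ε) * load ψ i e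

  zVal-nonpos : ∀ (ψ : Fin k → Fin n → ℚ) e → (∀ i → Covered ψ e i) → zVal ε ψ e ≤ℚ 0ℚ
  zVal-nonpos ψ e covered = foldr-⊔-lub _ (allFin k) ℚP.≤-refl (λ i → p-q≤0 (covered i))

  zVal≤weight : ∀ (ψ : Fin k → Fin n → ℚ) e → NonNeg ψ → 0ℚ ≤ℚ ew e →
    zVal ε ψ e ≤ℚ ew e
  zVal≤weight ψ e ψ≥0 0≤w =
    foldr-⊔-lub _ (allFin k) 0≤w (λ i → p-q≤p (ew e) (0≤[1+ε]p 0≤ε (load-nonneg ψ≥0 i e)))

  module Accounting (F : Fin k → Fin n → ℚ) (F≥0 : NonNeg F) where

    z : Edge n → ℚ
    z = zVal ε F

    Stacked : Fin k → Edge n → Set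
    Stacked c e = 0ℚ ≤ℚ ew e × (∀ i → i Fin.≤ c → Covered F e i)

    record Inv (s : State n k) : Set where
      field
        nonneg  : NonNeg (φ s)
        stacked : ∀ c → All (Stacked c) (stack s c)
    open Inv

    updList-stacked : ∀ {s} c {l} → Inv s → All (Stacked c) l →
      ∀ j → All (Stacked j) (updList (stack s) c l j)
    updList-stacked {s} c {l} inv l-stacked =
      updList-elim (λ j → All (Stacked j)) (stack s) c l l-stacked (stacked inv)

    Φ : State n k → ℚ
    Φ s = total z (stack s) + weightOf s

    Accrues : {A : Set} → (State n k → A → State n k) → (A → Set) → (A → ℚ) → Set
    Accrues f P h =
      ∀ s a → Inv s → P a → φ (f s a) ≼ F → Inv (f s a) × Φ s + h a ≤ℚ Φ (f s a)

    foldl-accrues : ∀ {A} {f : State n k → A → State n k} {P h} →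
      Inflationary f → Accrues f P h → Accrues (foldl f) (All P) (λ as → sumℚ (map h as))
    foldl-accrues f↑ f-acc s [] inv [] _ = inv , ℚP.≤-reflexive (ℚP.+-identityʳ (Φ s))
    foldl-accrues {f = f} {h = h} f↑ f-acc s (a ∷ as) inv (pa ∷ pas) bound = proj₁ rest , (begin
      Φ s + (h a + sumℚ (map h as))  ≡⟨ ℚP.+-assoc (Φ s) (h a) _ ⟨
      (Φ s + h a) + sumℚ (map h as)  ≤⟨ ℚP.+-monoˡ-≤ _ (proj₂ step) ⟩
      Φ t + sumℚ (map h as)          ≤⟨ proj₂ rest ⟩
      Φ (foldl f t as)               ∎)
      where
      open ℚP.≤-Reasoning
      t = f s a
      t≥0 = NonNeg-≼ (nonneg inv) (f↑ s a (nonneg inv))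
      step = f-acc s a inv pa (≼-trans (foldl-inflationary f↑ t as t≥0) bound)
      rest = foldl-accrues f↑ f-acc t as (proj₁ step) pas bound

    Φ-push : ∀ (s t : State n k) c e →
      stack t ≡ updList (stack s) c (e ∷ stack s c) → match t ≡ match s → Φ s + z e ≡ Φ t
    Φ-push s t c e stack-t match-t = begin
      (P + weightOf s) + z e                          ≡⟨ xy∙z≈zx∙y P (weightOf s) (z e) ⟩
      (z e + P) + weightOf s                          ≡⟨ cong (_+ weightOf s) (total-push z _ c e) ⟨
      total z (updList (stack s) c (e ∷ stack s c)) + weightOf s
        ≡⟨ cong₂ _+_ (cong (total z) stack-t) (cong (total ew) match-t) ⟨
      Φ t                                             ∎
      where
      open ≡-Reasoning
      P = total z (stack s)

    Φ-match : ∀ (s : State n k) c e →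
      Φ (st (φ s) (stack s) (updList (match s) c (e ∷ match s c))) ≡ Φ s + ew e
    Φ-match s c e = begin
      P + total ew (updList (match s) c (e ∷ match s c))  ≡⟨ cong (P +_) (total-push ew _ c e) ⟩
      P + (ew e + weightOf s)                             ≡⟨ xy∙z≈x∙zy P (weightOf s) (ew e) ⟨
      (P + weightOf s) + ew e                             ∎
      where
      open ≡-Reasoning
      P = total z (stack s)

    Φ-clear : ∀ (s : State n k) c →
      Φ s ≡ Φ (st (φ s) (updList (stack s) c []) (match s)) + sumℚ (map z (stack s c))
    Φ-clear s c = begin
      total z (stack s) + weightOf s        ≡⟨ cong (_+ weightOf s) (total-clear z (stack s) c) ⟩
      (X + P₁) + weightOf s                 ≡⟨ xy∙z≈yz∙x X P₁ (weightOf s) ⟩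
      (P₁ + weightOf s) + X                 ∎
      where
      open ≡-Reasoning
      X = sumℚ (map z (stack s c))
      P₁ = total z (updList (stack s) c [])

    Φ-initState : Φ (initState n k) ≡ 0ℚ
    Φ-initState = trans (cong₂ _+_ (total-empty z (stack (initState n k)) λ _ → refl)
                                   (total-empty ew (match (initState n k)) λ _ → refl))
                        (ℚP.+-identityˡ 0ℚ)

    Φ-postPhase : ∀ s → Φ (postPhase ε s) ≡ weightOf (postPhase ε s)
    Φ-postPhase s = trans (cong (_+ weightOf (postPhase ε s)) (total-empty z _ (postPhase-clear s)))
                          (ℚP.+-identityˡ _)

    data Placement (s : State n k) (e : Edge n) (t : State n k) : Set where
      discarded : t ≡ s → (∀ i → Covered F e i) → Placement s e t
      pushed    : ∀ c → stack t ≡ updList (stack s) c (e ∷ stack s c) →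
                  (∀ i → i Fin.≤ c → Covered F e i) → Placement s e t

    tryColors-placement : ∀ cs (s : State n k) e → NonNeg (φ s) → AllPairs Fin._<_ cs →
      (∀ i → i ∈ cs ⊎ Covered F e i) → φ (tryColors ε cs s e) ≼ F →
      Placement s e (tryColors ε cs s e)
    tryColors-placement [] s e s≥0 [] cover bound = discarded refl covered
      where
      covered : ∀ i → Covered F e i
      covered i with cover i
      ... | inj₂ covered-i = covered-i
    tryColors-placement (c ∷ cs) s e s≥0 (c<cs ∷ sorted) cover bound
      with (1ℚ + ε) * load (φ s) c e ≤? ew e
    ... | yes accept = pushed c refl covered
      where
      covered-c : Covered F e c
      covered-c = ℚP.≤-trans (raise-covers (φ s) c e (accept-slack s≥0 accept))
                    (ℚP.≤-trans (load-mono bound c e) (p≤[1+ε]p 0≤ε (load-nonneg F≥0 c e)))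
      covered : ∀ i → i Fin.≤ c → Covered F e i
      covered i i≤c with cover i
      ... | inj₁ (here refl)  = covered-c
      ... | inj₁ (there i∈cs) = ⊥-elim (ℕ.<⇒≱ (All.lookup c<cs i∈cs) i≤c)
      ... | inj₂ covered-i    = covered-i
    ... | no reject = tryColors-placement cs s e s≥0 sorted cover′ bound
      where
      φ≼F = ≼-trans (tryColors-inflationary cs s e s≥0) bound
      covered-c : Covered F e c
      covered-c = ℚP.≤-trans (ℚP.<⇒≤ (ℚP.≰⇒> reject)) ([1+ε]*-mono 0≤ε (load-mono φ≼F c e))
      cover′ : ∀ i → i ∈ cs ⊎ Covered F e i
      cover′ i with cover i
      ... | inj₁ (here refl)  = inj₂ covered-c
      ... | inj₁ (there i∈cs) = inj₁ i∈cs
      ... | inj₂ covered-i    = inj₂ covered-i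

    tryColors-accrues : ∀ cs (s : State n k) e → Inv s → 0ℚ ≤ℚ ew e → AllPairs Fin._<_ cs →
      (∀ i → i ∈ cs ⊎ Covered F e i) → φ (tryColors ε cs s e) ≼ F →
      Inv (tryColors ε cs s e) × Φ s + z e ≤ℚ Φ (tryColors ε cs s e)
    tryColors-accrues cs s e inv 0≤w sorted cover bound
      with tryColors-placement cs s e (nonneg inv) sorted cover bound
    ... | discarded t≡s covered =
      subst Inv (sym t≡s) inv ,
      subst (Φ s + z e ≤ℚ_) (cong Φ (sym t≡s)) (p+q≤p (Φ s) (zVal-nonpos F e covered))
    ... | pushed c stack-t covered =
      inv′ , ℚP.≤-reflexive (Φ-push s t c e stack-t (tryColors-match cs s e))
      where
      t = tryColors ε cs s e
      inv′ : Inv t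
      inv′ = record
        { nonneg  = NonNeg-≼ (nonneg inv) (tryColors-inflationary cs s e (nonneg inv))
        ; stacked = λ j → subst (All (Stacked j)) (sym (cong-app stack-t j))
                             (updList-stacked c inv ((0≤w , covered) ∷ stacked inv c) j)
        }

    popStep-accrues : ∀ c → Accrues (popStep ε c) (Stacked c) z
    popStep-accrues c s e inv (0≤w , covered) bound
      with touches (eu e) (match s c) ∨ touches (ev e) (match s c)
    ... | true  = tryColors-accrues (colorsAbove c) s e inv 0≤w
                    (AllPairs.filter⁺ (c <?_) allFin-sorted) cover bound
      where
      cover : ∀ i → i ∈ colorsAbove c ⊎ Covered F e i
      cover i with c <? i
      ... | yes c<i = inj₁ (∈-filter⁺ (c <?_) (∈-allFin i) c<i)
      ... | no c≮i  = inj₂ (covered i (ℕ.≮⇒≥ c≮i))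
    ... | false =
      record { nonneg = nonneg inv ; stacked = stacked inv } ,
      subst (Φ s + z e ≤ℚ_) (sym (Φ-match s c e))
            (ℚP.+-monoʳ-≤ (Φ s) (zVal≤weight F e F≥0 0≤w))

    processColor-accrues : Accrues (processColor ε) (λ _ → ⊤) (λ _ → 0ℚ)
    processColor-accrues s c inv _ bound = proj₁ popped , (begin
      Φ s + 0ℚ                          ≡⟨ ℚP.+-identityʳ (Φ s) ⟩
      Φ s                               ≡⟨ Φ-clear s c ⟩
      Φ s₁ + sumℚ (map z (stack s c))   ≤⟨ proj₂ popped ⟩
      Φ (processColor ε s c)            ∎)
      where
      open ℚP.≤-Reasoning
      s₁ = st (φ s) (updList (stack s) c []) (match s)
      inv₁ : Inv s₁
      inv₁ = record { nonneg = nonneg inv ; stacked = updList-stacked c inv [] }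
      popped = foldl-accrues (popStep-inflationary c) (popStep-accrues c)
                 s₁ (stack s c) inv₁ (stacked inv c) bound

    streamPhase-accrues : ∀ es → All (λ e → 0ℚ ≤ℚ ew e) es → φ (streamPhase k ε es) ≼ F →
      Inv (streamPhase k ε es) × sumℚ (map z es) ≤ℚ Φ (streamPhase k ε es)
    streamPhase-accrues es 0≤ws bound = proj₁ streamed , (begin
      sumℚ (map z es)                      ≡⟨ ℚP.+-identityˡ _ ⟨
      0ℚ + sumℚ (map z es)                 ≡⟨ cong (_+ sumℚ (map z es)) Φ-initState ⟨
      Φ (initState n k) + sumℚ (map z es)  ≤⟨ proj₂ streamed ⟩
      Φ (streamPhase k ε es)               ∎)
      where
      open ℚP.≤-Reasoning
      step : Accrues (λ s e → tryColors ε (allFin k) s e) (λ e → 0ℚ ≤ℚ ew e) z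
      step s e inv 0≤w = tryColors-accrues (allFin k) s e inv 0≤w allFin-sorted (inj₁ ∘ ∈-allFin)
      inv₀ : Inv (initState n k)
      inv₀ = record { nonneg = initState-nonneg ; stacked = λ _ → [] }
      streamed = foldl-accrues (tryColors-inflationary (allFin k)) step _ es inv₀ 0≤ws bound

    postPhase-accrues : ∀ s → Inv s → φ (postPhase ε s) ≼ F → Φ s ≤ℚ Φ (postPhase ε s)
    postPhase-accrues s inv bound = begin
      Φ s                                     ≡⟨ ℚP.+-identityʳ (Φ s) ⟨
      Φ s + 0ℚ                                ≡⟨ cong (Φ s +_) (sumℚ-zeros _ (allFin k) λ _ → refl) ⟨
      Φ s + sumℚ (map (λ _ → 0ℚ) (allFin k))  ≤⟨ proj₂ processed ⟩
      Φ (postPhase ε s)                       ∎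
      where
      open ℚP.≤-Reasoning
      processed = foldl-accrues processColor-inflationary processColor-accrues
                    s (allFin k) inv (All.universal (λ _ → tt) (allFin k)) bound

  STK-credit : ∀ es → All (λ e → 0ℚ ≤ℚ ew e) es →
    sumℚ (map (zVal ε (φ (STK k ε es))) es) ≤ℚ weightOf (STK k ε es)
  STK-credit es 0≤ws = begin
    sumℚ (map z es)         ≤⟨ proj₂ streamed ⟩
    Φ (streamPhase k ε es)  ≤⟨ postPhase-accrues _ (proj₁ streamed) ≼-refl ⟩
    Φ (STK k ε es)          ≡⟨ Φ-postPhase _ ⟩
    weightOf (STK k ε es)   ∎
    where
    open ℚP.≤-Reasoning
    open Accounting (φ (STK k ε es)) (NonNeg-≼ (streamPhase-nonneg es) (streamPhase-≼-STK es))
    streamed = streamPhase-accrues es 0≤ws (streamPhase-≼-STK es)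

mainTheorem3 : (n k : ℕ) → 1 ≤ k → (ε : ℚ) → 0ℚ < ε →
    (es : List (Edge n)) → IsWeightedGraph es →
    sumℚ (map (zVal ε (φ (STK k ε es))) es) ≤ℚ weightOf (STK k ε es)
mainTheorem3 n k _ ε 0<ε es (_ , positive , _) =
  STK-credit (ℚP.<⇒≤ 0<ε) {n} {k} es (All.map ℚP.<⇒≤ positive)
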